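{- Let $\ell\ge2$ be an integer, $G$ a group, and $A,B\subseteq G$. Suppose $A$ has no $\ell$-$\mathrm{HOP}_2$ and $B$ has no $2$-$\mathrm{HOP}_2$. Then $A\cap B$ has no $\ell$-$\mathrm{HOP}_2$.
   Context: A subset $X\subseteq G$ has $k$-$\mathrm{HOP}_2$ if there are $x_1,\dots,x_k,y_1,\dots,y_k,z_1,\dots,z_k\in G$ such that $x_i\cdot y_j\cdot z_m\in X\iff i<j+m$. -}

module Defs where

open import Level using (Level; _⊔_; suc)
open import Algebra.Bundles using (Group)
open import Data.Nat using (ℕ; _+_; _<_)
open import Data.Fin using (Fin; toℕ)
open import Data.Product using (Σ; _×_)
open import Function.Bundles using (_⇔_)

module _ {c ℓ : Level} (G : Group c ℓ) where
  open Group G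

  Subset : (p : Level) → Set (c ⊔ Level.suc p)
  Subset p = Carrier → Set p

  -- Indices are Fin k (0-based); 1-based i < j + m becomes
  -- (toℕ i + 1) < (toℕ j + 1) + (toℕ m + 1).
  HasHOP₂ : {p : Level} → ℕ → Subset p → Set (c ⊔ p)
  HasHOP₂ k X =
    Σ (Fin k → Carrier) λ x →
    Σ (Fin k → Carrier) λ y →
    Σ (Fin k → Carrier) λ z →
      ∀ (i j m : Fin k) →
        X ((x i ∙ y j) ∙ z m) ⇔ (Data.Nat.suc (toℕ i) < Data.Nat.suc (toℕ j) + Data.Nat.suc (toℕ m))

  _∩_ : {p q : Level} → Subset p → Subset q → Subset (p ⊔ q)
  (A ∩ B) g = A g × B g

{-# OPTIONS --safe #-}
-- Suppose x, y, z witness an l-HOP₂ for A ∩ B. They witness one for A as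
-- well unless some x_i y_j z_m lies in A although i ≥ j + m; that product is
-- then outside B, while B contains every x_i y_j z_m with i < j + m. The eight
-- products of x_1 or x_i with y_j or y_l and z_m or z_l then show that B has a
-- 2-HOP₂, since among the 1-based index triples in {1,2}³ only (2, 1, 1) violates
-- i < j + m.
module Submission where

open import Defs
open import Level using (Level)
open import Algebra.Bundles using (Group)
open import Data.Nat using (ℕ; suc; _≤_; _<_; _+_; z≤n; s≤s)
open import Data.Nat.Properties using (_<?_; ≤-refl; ≤-trans; m≤n+m; +-comm)
open import Data.Fin using (Fin; toℕ; fromℕ)
open import Data.Fin.Patterns using (0F; 1F)
open import Data.Fin.Properties using (≤fromℕ)
open import Data.Product using (_,_; proj₁; proj₂)
open import Data.Empty using (⊥-elim)
open import Function.Base using (_∘_)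
open import Function.Bundles using (mk⇔; Equivalence)
open import Relation.Nullary using (¬_; yes; no)
open import Relation.Binary.PropositionalEquality using (subst)

HOPOrder : ∀ {k} → Fin k → Fin k → Fin k → Set
HOPOrder i j m = suc (toℕ i) < suc (toℕ j) + suc (toℕ m)

m≤o⇒1+m<[1+n]+[1+o] : ∀ {m} n {o} → m ≤ o → suc m < suc n + suc o
m≤o⇒1+m<[1+n]+[1+o] n {o} m≤o = s≤s (≤-trans (s≤s m≤o) (m≤n+m (suc o) n))

m≤n⇒1+m<[1+n]+[1+o] : ∀ {m} n {o} → m ≤ n → suc m < suc n + suc o
m≤n⇒1+m<[1+n]+[1+o] {m} n {o} m≤n =
  subst (suc m <_) (+-comm (suc o) (suc n)) (m≤o⇒1+m<[1+n]+[1+o] o m≤n)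

module _ {c ℓ : Level} (G : Group c ℓ) where
  open Group G using (Carrier; _∙_)

  ContainsUpperPattern : ∀ {p k} → Subset G p → (x y z : Fin k → Carrier) → Set p
  ContainsUpperPattern X x y z = ∀ i j m → HOPOrder i j m → X ((x i ∙ y j) ∙ z m)

  AvoidsLowerPattern : ∀ {p k} → Subset G p → (x y z : Fin k → Carrier) → Set p
  AvoidsLowerPattern X x y z = ∀ i j m → ¬ HOPOrder i j m → ¬ X ((x i ∙ y j) ∙ z m)

  hasHOP₂-intro : ∀ {p k} (X : Subset G p) (x y z : Fin k → Carrier) →
    ContainsUpperPattern X x y z → AvoidsLowerPattern X x y z → HasHOP₂ G k X
  hasHOP₂-intro X x y z upper lower = x , y , z , λ i j m → mk⇔ (ordered i j m) (upper i j m)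
    where
    ordered : ∀ i j m → X ((x i ∙ y j) ∙ z m) → HOPOrder i j m
    ordered i j m xijm with suc (toℕ i) <? suc (toℕ j) + suc (toℕ m)
    ... | yes o  = o
    ... | no ¬o = ⊥-elim (lower i j m ¬o xijm)

  hasHOP₂-2-intro : ∀ {p} (X : Subset G p) (x y z : Fin 2 → Carrier) →
    ContainsUpperPattern X x y z → ¬ X ((x 1F ∙ y 0F) ∙ z 0F) → HasHOP₂ G 2 X
  hasHOP₂-2-intro X x y z upper miss = hasHOP₂-intro X x y z upper lower
    where
    lower : AvoidsLowerPattern X x y z
    lower 0F j  m  ¬o = ⊥-elim (¬o (m≤n⇒1+m<[1+n]+[1+o] (toℕ j) z≤n))
    lower 1F 0F 0F _  = miss
    lower 1F 0F 1F ¬o = ⊥-elim (¬o (m≤o⇒1+m<[1+n]+[1+o] 0 ≤-refl))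
    lower 1F 1F m  ¬o = ⊥-elim (¬o (m≤n⇒1+m<[1+n]+[1+o] 1 ≤-refl))

  containsUpperPattern⇒hasHOP₂-2 : ∀ {p k} (X : Subset G p) (x y z : Fin k → Carrier) →
    ContainsUpperPattern X x y z → ∀ i j m → ¬ X ((x i ∙ y j) ∙ z m) → HasHOP₂ G 2 X
  containsUpperPattern⇒hasHOP₂-2 {k = suc n} X x y z upper i j m miss =
    hasHOP₂-2-intro X (x ∘ pickˣ) (y ∘ pickʸ) (z ∘ pickᶻ) upper′ miss
    where
    pickˣ pickʸ pickᶻ : Fin 2 → Fin (suc n)
    pickˣ 0F = 0F
    pickˣ 1F = i
    pickʸ 0F = j
    pickʸ 1F = fromℕ n
    pickᶻ 0F = m
    pickᶻ 1F = fromℕ n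

    upper′ : ContainsUpperPattern X (x ∘ pickˣ) (y ∘ pickʸ) (z ∘ pickᶻ)
    upper′ 0F j′ m′ _ = upper 0F (pickʸ j′) (pickᶻ m′) (m≤n⇒1+m<[1+n]+[1+o] (toℕ (pickʸ j′)) z≤n)
    upper′ 1F 0F 0F (s≤s (s≤s ()))
    upper′ 1F 0F 1F _ = upper i j (fromℕ n) (m≤o⇒1+m<[1+n]+[1+o] (toℕ j) (≤fromℕ i))
    upper′ 1F 1F m′ _ =
      upper i (fromℕ n) (pickᶻ m′) (m≤n⇒1+m<[1+n]+[1+o] (toℕ (fromℕ n)) (≤fromℕ i))

lemma2p15 : {c ℓ p q : Level} (G : Group c ℓ) (l : ℕ) → 2 ≤ l →
    (A : Subset G p) (B : Subset G q) →
    ¬ HasHOP₂ G l A → ¬ HasHOP₂ G 2 B → ¬ HasHOP₂ G l (_∩_ G A B)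
lemma2p15 G l _ A B noHOP-A noHOP-B (x , y , z , hop) =
  noHOP-A (hasHOP₂-intro G A x y z inA lowerA)
  where
  inA∩B : ContainsUpperPattern G (_∩_ G A B) x y z
  inA∩B i j m = Equivalence.from (hop i j m)

  inA : ContainsUpperPattern G A x y z
  inA i j m o = proj₁ (inA∩B i j m o)

  inB : ContainsUpperPattern G B x y z
  inB i j m o = proj₂ (inA∩B i j m o)

  lowerA : AvoidsLowerPattern G A x y z
  lowerA i j m ¬o a = noHOP-B (containsUpperPattern⇒hasHOP₂-2 G B x y z inB i j m
    (λ b → ¬o (Equivalence.to (hop i j m) (a , b))))
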